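{- Let $P$ be a standard weighted graded poset of rank $d$ possessing Property AL. Then for any $0\le l\le d-1$ and $f\in C^l$, \[\langle A_lf,f\rangle=\sum_{s\in P(l-1)}m(s)\langle A_sf_s,f_s\rangle_s.\]
   Context: Graded poset: finite poset $(P,\le)$ with order-preserving rank $\rho:P\to\mathbb{Z}_{\ge-1}$, $\rho(b)=\rho(a)+1$ when $b$ covers $a$ ($a\lhd b$), unique element $\varnothing$ of rank $-1$, $P(i)=\rho^{ -1}(i)$, rank $d$, pure. Weighted: $m:P\to\mathbb{R}_{>0}$, $p_{y\to x}>0$ iff $x\lhd y$, $\sum_{x\lhd y}p_{y\to x}=1$, $m(x)=\sum_{y\rhd x}p_{y\to x}m(y)$ for non-maximal $x$, $m(\varnothing)=1$. Standard: $p_{y\to x}=1/N(y)$, $N(y)$ = number of elements covered by $y$. $\mathrm{Ch}(y\to x)$: maximal chains $x=c_1\lhd\cdots\lhd c_m=y$, $p(c)=\prod p_{c_{i+1}\to c_i}$. $C^i=\mathbb{R}^{P(i)}$, $\langle f,g\rangle=\sum m(x)f(x)g(x)$. Link $P_s=\{y\ge s\}$ with rank $\rho(y)-\rho(s)-1$, $m_s(y)=\frac{m(y)}{m(s)}\sum_{c\in\mathrm{Ch}(y\to s)}p(c)$, $(p_s)_{z\to y}=p_{z\to y}\frac{\sum_{\mathrm{Ch}(y\to s)}p(c)}{\sum_{\mathrm{Ch}(z\to s)}p(c)}$, inner product $\langle\cdot,\cdot\rangle_s$; for $f\in C^l$, $s\in P(l-1)$, $f_s\in C^0(P_s)$ is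 $f_s(y)=f(y)$. The $l$-th adjacency operator: $(A_lf)(y)=\sum_{x\in P(l),x\ne y}\big(\sum_{z\rhd x,y}\frac{m(z)p_{z\to x}p_{z\to y}}{(1-p_{z\to y})m(y)}\big)f(x)$ (each element of $P(l+1)$ assumed to cover at least two elements); $A_s$ is the $0$-th adjacency operator of $P_s$ (same formula with $m_s,p_s$). Property AL: for every $0\le l\le d-1$ and all $x\ne y\in P(l)$, $\sum_{z\rhd x,y}\frac{m(z)p_{z\to x}p_{z\to y}}{1-p_{z\to x}}=\sum_{z\rhd x,y}m(z)p_{z\to x}p_{z\to y}\sum_{s\lhd x,y}\frac{p_{x\to s}p_{y\to s}}{\sum_{c\in\mathrm{Ch}(z\to s),c\ne(s,x,z)}p(c)}$. -}

module Defs where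

open import Level using (Level; 0ℓ; _⊔_) renaming (suc to lsuc)
open import Algebra.Bundles using (CommutativeRing)
open import Data.Nat as ℕ using (ℕ; zero; suc)
open import Data.Fin as Fin using (Fin)
open import Data.Fin.Properties using (any?)
open import Data.Bool using (Bool; true; false; if_then_else_)
open import Data.Product using (Σ; ∃; ∃₂; _×_; _,_)
open import Data.Product.Properties using () 
open import Relation.Nullary using (¬_; Dec; yes; no; does)
open import Relation.Nullary.Decidable using (_×-dec_; ¬?)
open import Relation.Binary using (Rel; Decidable; IsPartialOrder; IsStrictTotalOrder)
open import Relation.Binary.PropositionalEquality using (_≡_; _≢_)

-- Scalars: an ordered field (the reals are an instance).
-- The inverse is a total function; only its values on nonzero
-- elements are constrained.

record OrderedField (c ℓ : Level) : Set (lsuc (c ⊔ ℓ)) where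
  field
    commutativeRing : CommutativeRing c ℓ
  open CommutativeRing commutativeRing public
  infix 4 _<_
  infix 8 _⁻¹
  field
    _⁻¹                : Carrier → Carrier
    ⁻¹-cong            : ∀ {x y} → x ≈ y → x ⁻¹ ≈ y ⁻¹
    ⁻¹-inverse         : ∀ {x} → ¬ (x ≈ 0#) → x * x ⁻¹ ≈ 1#
    _<_                : Rel Carrier ℓ
    isStrictTotalOrder : IsStrictTotalOrder _≈_ _<_
    0<1                : 0# < 1#
    +-monoˡ-<          : ∀ {a b} c → a < b → a + c < b + c
    *-pos              : ∀ {a b} → 0# < a → 0# < b → 0# < a * b

module Cover {n : ℕ} (_≤_ : Rel (Fin n) 0ℓ) (_≤?_ : Decidable _≤_) where

  infix 4 _<ₚ_ _⋖_
  _<ₚ_ : Rel (Fin n) 0ℓ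
  a <ₚ b = a ≤ b × a ≢ b

  _<ₚ?_ : Decidable _<ₚ_
  a <ₚ? b = (a ≤? b) ×-dec ¬? (a Fin.≟ b)

  _⋖_ : Rel (Fin n) 0ℓ
  x ⋖ y = x <ₚ y × ¬ (∃ λ c → x <ₚ c × c <ₚ y)

  _⋖?_ : Decidable _⋖_
  x ⋖? y = (x <ₚ? y) ×-dec ¬? (any? (λ c → (x <ₚ? c) ×-dec (c <ₚ? y)))

  Maximal : Fin n → Set
  Maximal x = ∀ y → x ≤ y → y ≡ x

-- Graded posets of rank d.  Elements are Fin n.  We store the shifted
-- rank  rk = ρ + 1 : Fin n → ℕ , so the unique element ∅ of rank -1
-- has rk ∅ = 0, and P(i) = { x | rk x ≡ i + 1 }.

record GradedPoset (d : ℕ) : Set₁ where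
  field
    n              : ℕ
    _≤_            : Rel (Fin n) 0ℓ
    isPartialOrder : IsPartialOrder _≡_ _≤_
    _≤?_           : Decidable _≤_
  open Cover _≤_ _≤?_ public
  field
    rk         : Fin n → ℕ
    rk-mono    : ∀ {a b} → a ≤ b → rk a ℕ.≤ rk b
    rk-cover   : ∀ {a b} → a ⋖ b → rk b ≡ suc (rk a)
    ∅          : Fin n
    rk-∅       : rk ∅ ≡ 0
    ∅-unique   : ∀ x → rk x ≡ 0 → x ≡ ∅
    rk-bound   : ∀ x → rk x ℕ.≤ suc d
    pure       : ∀ x → Maximal x → rk x ≡ suc d

module Sums {c ℓ : Level} (K : OrderedField c ℓ) where
  open OrderedField K

  sumFin : ∀ {n} → (Fin n → Carrier) → Carrier
  sumFin {zero}  f = 0#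
  sumFin {suc n} f = f Fin.zero + sumFin (λ i → f (Fin.suc i))

  sumWhere : ∀ {n p} {P : Fin n → Set p} → (∀ i → Dec (P i)) → (Fin n → Carrier) → Carrier
  sumWhere P? f = sumFin (λ i → if does (P? i) then f i else 0#)

  countWhere : ∀ {n p} {P : Fin n → Set p} → (∀ i → Dec (P i)) → ℕ
  countWhere {zero}  P? = 0
  countWhere {suc n} P? = (if does (P? Fin.zero) then 1 else 0) ℕ.+ countWhere (λ i → P? (Fin.suc i))

  fromℕ : ℕ → Carrier
  fromℕ zero    = 0#
  fromℕ (suc k) = 1# + fromℕ k

module Weighted {c ℓ : Level} (K : OrderedField c ℓ) {d : ℕ} (P : GradedPoset d) where
  open OrderedField K
  open Sums K
  open GradedPoset P

  record Weighting : Set (c ⊔ ℓ) where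
    field
      m      : Fin n → Carrier
      -- p y x  is  p_{y→x}
      p      : Fin n → Fin n → Carrier
      m-pos  : ∀ x → 0# < m x
      p-pos  : ∀ x y → x ⋖ y → 0# < p y x
      p-zero : ∀ x y → ¬ (x ⋖ y) → p y x ≈ 0#
      p-sum  : ∀ y → y ≢ ∅ → sumWhere (λ x → x ⋖? y) (λ x → p y x) ≈ 1#
      m-rec  : ∀ x → ¬ Maximal x → m x ≈ sumWhere (λ y → x ⋖? y) (λ y → p y x * m y)
      m-∅    : m ∅ ≈ 1#

  N : Fin n → ℕ
  N y = countWhere (λ x → x ⋖? y)

  Standard : Weighting → Set ℓ
  Standard W = ∀ x y → x ⋖ y → Weighting.p W y x ≈ (fromℕ (N y)) ⁻¹

  module Ops (W : Weighting) where
    open Weighting W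

    -- chainSum k y x = Σ_{c ∈ Ch(y→x)} p(c), computed by following
    -- covering steps downward from y (k = fuel; paths have < n steps).
    chainSum′ : ℕ → Fin n → Fin n → Carrier
    chainSum′ zero    y x = if does (x Fin.≟ y) then 1# else 0#
    chainSum′ (suc k) y x =
      if does (x Fin.≟ y) then 1#
      else sumWhere (λ w → w ⋖? y) (λ w → p y w * chainSum′ k w x)

    chainSum : Fin n → Fin n → Carrier
    chainSum y x = chainSum′ n y x

    -- level sets: P(l) is rk ≡ suc l ;  P_s(0) = { y ≥ s | ρ y = ρ s + 1 }
    Lev : ℕ → Fin n → Set
    Lev l x = rk x ≡ suc l
    Lev? : ∀ l x → Dec (Lev l x)
    Lev? l x = rk x ℕ.≟ suc l

    -- P(l-1) = { s | rk s ≡ l }  (for l = 0 this is {∅})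
    LevPred : ℕ → Fin n → Set
    LevPred l s = rk s ≡ l
    LevPred? : ∀ l s → Dec (LevPred l s)
    LevPred? l s = rk s ℕ.≟ l

    LinkLev0 : Fin n → Fin n → Set
    LinkLev0 s y = s ≤ y × rk y ≡ suc (rk s)
    LinkLev0? : ∀ s y → Dec (LinkLev0 s y)
    LinkLev0? s y = (s ≤? y) ×-dec (rk y ℕ.≟ suc (rk s))

    m[_] : Fin n → Fin n → Carrier
    m[ s ] y = m y * m s ⁻¹ * chainSum y s

    p[_] : Fin n → Fin n → Fin n → Carrier
    p[ s ] z y = p z y * chainSum y s * (chainSum z s) ⁻¹

    adj : (M : Fin n → Carrier) (q : Fin n → Fin n → Carrier)
          {L : Fin n → Set} (L? : ∀ x → Dec (L x)) →
          (Fin n → Carrier) → Fin n → Carrier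
    adj M q L? f y =
      sumWhere (λ x → L? x ×-dec ¬? (x Fin.≟ y))
        (λ x → sumWhere (λ z → (x ⋖? z) ×-dec (y ⋖? z))
                 (λ z → M z * q z x * q z y * ((1# - q z y) * M y) ⁻¹)
               * f x)

    inner : (M : Fin n → Carrier) {L : Fin n → Set} (L? : ∀ x → Dec (L x)) →
            (Fin n → Carrier) → (Fin n → Carrier) → Carrier
    inner M L? g h = sumWhere L? (λ y → M y * g y * h y)

    A : ℕ → (Fin n → Carrier) → Fin n → Carrier
    A l = adj m p (Lev? l)

    ⟪_,_⟫[_] : (Fin n → Carrier) → (Fin n → Carrier) → ℕ → Carrier
    ⟪ g , h ⟫[ l ] = inner m (Lev? l) g h

    -- A_s on C^0(P_s) and ⟨·,·⟩_s on C^0(P_s);  f_s is f restricted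
    A[_] : Fin n → (Fin n → Carrier) → Fin n → Carrier
    A[ s ] = adj m[ s ] p[ s ] (LinkLev0? s)

    ⟪_,_⟫ₛ[_] : (Fin n → Carrier) → (Fin n → Carrier) → Fin n → Carrier
    ⟪ g , h ⟫ₛ[ s ] = inner m[ s ] (LinkLev0? s) g h

    -- Property AL (for 0 ≤ l ≤ d-1).  The sum over chains c ∈ Ch(z→s)
    -- with c ≠ (s,x,z) equals chainSum z s - p_{z→x} p_{x→s}.
    PropertyAL : Set ℓ
    PropertyAL = ∀ l → l ℕ.< d → ∀ x y → Lev l x → Lev l y → x ≢ y →
      sumWhere (λ z → (x ⋖? z) ×-dec (y ⋖? z))
        (λ z → m z * p z x * p z y * (1# - p z x) ⁻¹)
      ≈
      sumWhere (λ z → (x ⋖? z) ×-dec (y ⋖? z))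
        (λ z → m z * p z x * p z y *
          sumWhere (λ s → (s ⋖? x) ×-dec (s ⋖? y))
            (λ s → p x s * p y s * (chainSum z s - p z x * p x s) ⁻¹))

    CoversTwo : ℕ → Set
    CoversTwo l = ∀ z → Lev (suc l) z → ∃₂ λ x y → x ≢ y × x ⋖ z × y ⋖ z

module Submission where

-- Both sides are sums, over diamonds s ⋖ x, y ⋖ z with x ≠ y in P(l), of f(x) f(y) times a weight.
-- In the link P_s a rank-one element x reaches s only through the cover s ⋖ x, so m_s and p_s
-- turn the (x, y, z)-coefficient of m(s) ⟨A_s f_s, f_s⟩_s into
--   m(z) p_{z→x} p_{z→y} p_{x→s} p_{y→s} / (Σ_{Ch(z→s)} p(c) − p_{z→y} p_{y→s}),
-- which vanishes unless s is covered by both x and y; the denominator is positive because the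
-- chain through x survives.  On the left, standardness gives p_{z→x} = p_{z→y}, so the
-- coefficient of ⟨A_l f, f⟩ is m(z) p_{z→x} p_{z→y} / (1 − p_{z→x}), and Property AL splits its
-- sum over z into the same diamond terms with the roles of x and y exchanged.

open import Defs
open import Level using (Level)
open import Data.Nat using (ℕ; _<_)
open import Data.Fin using (Fin)
open import Data.Nat as ℕ using (zero; suc)
import Data.Nat.Properties as ℕ
open import Data.Fin as Fin using (punchIn)
open import Data.Fin.Properties using (punchInᵢ≢i; punchIn-punchOut)
open import Data.Bool using (Bool; true; false; _∧_; if_then_else_)
open import Data.Product using (_×_; _,_; ∃; proj₁)
open import Data.Sum using (_⊎_; inj₁; inj₂)
open import Data.Empty using (⊥-elim)
open import Function using (_∘_)
open import Relation.Nullary using (¬_; Dec; yes; no; does)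
open import Relation.Nullary.Decidable using (dec-true; dec-false; _×-dec_; ¬?)
open import Relation.Binary.Structures using (IsStrictTotalOrder)
open import Relation.Binary.PropositionalEquality as ≡ using (_≡_; _≢_)

module OrderedFieldProperties {c ℓ} (K : OrderedField c ℓ) where
  open OrderedField K renaming (_<_ to _<ᶠ_)
  open import Relation.Binary.Reasoning.Setoid setoid
  open import Algebra.Solver.Ring.NaturalCoefficients.Default commutativeSemiring
  open import Algebra.Properties.Ring ring using (-‿distribˡ-*)
  private module STO = IsStrictTotalOrder isStrictTotalOrder

  Nonzero : Carrier → Set ℓ
  Nonzero x = ¬ (x ≈ 0#)

  NonNegative : Carrier → Set ℓ
  NonNegative x = 0# <ᶠ x ⊎ 0# ≈ x

  pos⇒nonzero : ∀ {x} → 0# <ᶠ x → Nonzero x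
  pos⇒nonzero 0<x x≈0 = STO.irrefl (sym x≈0) 0<x

  pos-resp-≈ : ∀ {x y} → x ≈ y → 0# <ᶠ x → 0# <ᶠ y
  pos-resp-≈ = STO.<-respʳ-≈

  pos+nonneg : ∀ {a b} → 0# <ᶠ a → NonNegative b → 0# <ᶠ a + b
  pos+nonneg {a} 0<a (inj₂ 0≈b) = pos-resp-≈ (trans (sym (+-identityʳ a)) (+-cong refl 0≈b)) 0<a
  pos+nonneg {a} {b} 0<a (inj₁ 0<b) =
    STO.trans (pos-resp-≈ (sym (+-identityˡ b)) 0<b) (+-monoˡ-< b 0<a)

  nonneg-+ : ∀ {a b} → NonNegative a → NonNegative b → NonNegative (a + b)
  nonneg-+ (inj₁ 0<a) b≥0 = inj₁ (pos+nonneg 0<a b≥0)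
  nonneg-+ {a} {b} (inj₂ 0≈a) (inj₁ 0<b) = inj₁ (pos-resp-≈ (trans (sym (+-identityˡ b)) (+-cong 0≈a refl)) 0<b)
  nonneg-+ (inj₂ 0≈a) (inj₂ 0≈b) = inj₂ (trans (sym (+-identityˡ 0#)) (+-cong 0≈a 0≈b))

  nonneg-* : ∀ {a b} → NonNegative a → NonNegative b → NonNegative (a * b)
  nonneg-* (inj₁ 0<a) (inj₁ 0<b) = inj₁ (*-pos 0<a 0<b)
  nonneg-* {a} _ (inj₂ 0≈b) = inj₂ (trans (sym (zeroʳ a)) (*-cong refl 0≈b))
  nonneg-* {b = b} (inj₂ 0≈a) (inj₁ _) = inj₂ (trans (sym (zeroˡ b)) (*-cong 0≈a refl))

  1≉0 : Nonzero 1#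
  1≉0 = pos⇒nonzero 0<1

  ⁻¹-unique : ∀ {a b} → a * b ≈ 1# → a ⁻¹ ≈ b
  ⁻¹-unique {a} {b} ab≈1 = begin
    a ⁻¹              ≈⟨ sym (*-identityʳ _) ⟩
    a ⁻¹ * 1#         ≈⟨ *-cong refl (sym ab≈1) ⟩
    a ⁻¹ * (a * b)    ≈⟨ solve 3 (λ a⁻¹ a b → a⁻¹ :* (a :* b) := (a :* a⁻¹) :* b) refl (a ⁻¹) a b ⟩
    (a * a ⁻¹) * b    ≈⟨ *-cong (⁻¹-inverse a≉0) refl ⟩
    1# * b            ≈⟨ *-identityˡ b ⟩
    b                 ∎
    where
    a≉0 : Nonzero a
    a≉0 a≈0 = 1≉0 (trans (sym ab≈1) (trans (*-cong a≈0 refl) (zeroˡ b)))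

  *-nonzero : ∀ {a b} → Nonzero a → Nonzero b → Nonzero (a * b)
  *-nonzero {a} {b} a≉0 b≉0 ab≈0 = b≉0 (begin
    b                 ≈⟨ sym (*-identityˡ b) ⟩
    1# * b            ≈⟨ *-cong (sym (⁻¹-inverse a≉0)) refl ⟩
    (a * a ⁻¹) * b    ≈⟨ solve 3 (λ a⁻¹ a b → (a :* a⁻¹) :* b := a⁻¹ :* (a :* b)) refl (a ⁻¹) a b ⟩
    a ⁻¹ * (a * b)    ≈⟨ *-cong refl ab≈0 ⟩
    a ⁻¹ * 0#         ≈⟨ zeroʳ _ ⟩
    0#                ∎)

  ⁻¹-nonzero : ∀ {a} → Nonzero a → Nonzero (a ⁻¹)
  ⁻¹-nonzero {a} a≉0 a⁻¹≈0 = 1≉0 (trans (sym (⁻¹-inverse a≉0)) (trans (*-cong refl a⁻¹≈0) (zeroʳ a)))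

  ⁻¹-distrib-* : ∀ {a b} → Nonzero a → Nonzero b → (a * b) ⁻¹ ≈ a ⁻¹ * b ⁻¹
  ⁻¹-distrib-* {a} {b} a≉0 b≉0 = ⁻¹-unique (begin
    (a * b) * (a ⁻¹ * b ⁻¹)    ≈⟨ solve 4 (λ a b a⁻¹ b⁻¹ → (a :* b) :* (a⁻¹ :* b⁻¹) := (a :* a⁻¹) :* (b :* b⁻¹))
                                    refl a b (a ⁻¹) (b ⁻¹) ⟩
    (a * a ⁻¹) * (b * b ⁻¹)    ≈⟨ *-cong (⁻¹-inverse a≉0) (⁻¹-inverse b≉0) ⟩
    1# * 1#                    ≈⟨ *-identityˡ 1# ⟩
    1#                         ∎)

  ⁻¹-involutive : ∀ {a} → Nonzero a → a ⁻¹ ⁻¹ ≈ a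
  ⁻¹-involutive {a} a≉0 = ⁻¹-unique (trans (*-comm (a ⁻¹) a) (⁻¹-inverse a≉0))

  *-cancel-⁻¹ : ∀ {a b} → Nonzero a → Nonzero b → a * (b * a) ⁻¹ ≈ b ⁻¹
  *-cancel-⁻¹ {a} {b} a≉0 b≉0 = begin
    a * (b * a) ⁻¹        ≈⟨ *-cong refl (⁻¹-distrib-* b≉0 a≉0) ⟩
    a * (b ⁻¹ * a ⁻¹)     ≈⟨ solve 3 (λ a b⁻¹ a⁻¹ → a :* (b⁻¹ :* a⁻¹) := (a :* a⁻¹) :* b⁻¹) refl a (b ⁻¹) (a ⁻¹) ⟩
    (a * a ⁻¹) * b ⁻¹     ≈⟨ *-cong (⁻¹-inverse a≉0) refl ⟩
    1# * b ⁻¹             ≈⟨ *-identityˡ _ ⟩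
    b ⁻¹                  ∎

  1-x*y⁻¹ : ∀ {x y} → Nonzero y → 1# - x * y ⁻¹ ≈ (y - x) * y ⁻¹
  1-x*y⁻¹ {x} {y} y≉0 = sym (begin
    (y - x) * y ⁻¹             ≈⟨ distribʳ (y ⁻¹) y (- x) ⟩
    y * y ⁻¹ + - x * y ⁻¹      ≈⟨ +-cong (⁻¹-inverse y≉0) (sym (-‿distribˡ-* x (y ⁻¹))) ⟩
    1# - x * y ⁻¹              ∎)

  ≈0-by-factor : ∀ {t a u} → t ≈ a * u → a ≈ 0# → t ≈ 0#
  ≈0-by-factor {u = u} t≈au a≈0 = trans t≈au (trans (*-cong a≈0 refl) (zeroˡ u))

module GuardedSums {c ℓ} (K : OrderedField c ℓ) where
  open OrderedField K renaming (_<_ to _<ᶠ_)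
  open OrderedFieldProperties K
  open Sums K
  open import Algebra.Properties.Semiring.Sum semiring
    using (sum; sum-cong-≋; sum-replicate-zero; ∑-comm; *-distribʳ-sum; sum-remove)
  open import Algebra.Properties.AbelianGroup +-abelianGroup using (xyx⁻¹≈y)
  open import Data.Vec.Functional using (removeAt)
  open import Relation.Binary.Reasoning.Setoid setoid

  when : Bool → Carrier → Carrier
  when b t = if b then t else 0#

  sumFin≈sum : ∀ {n} (f : Fin n → Carrier) → sumFin f ≈ sum f
  sumFin≈sum {zero}  f = refl
  sumFin≈sum {suc n} f = +-cong refl (sumFin≈sum (f ∘ Fin.suc))

  sumFin-cong : ∀ {n} {f g : Fin n → Carrier} → (∀ i → f i ≈ g i) → sumFin f ≈ sumFin g
  sumFin-cong {f = f} {g} f≈g = begin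
    sumFin f  ≈⟨ sumFin≈sum f ⟩
    sum f     ≈⟨ sum-cong-≋ f≈g ⟩
    sum g     ≈⟨ sumFin≈sum g ⟨
    sumFin g  ∎

  sumFin-zero : ∀ {n} {f : Fin n → Carrier} → (∀ i → f i ≈ 0#) → sumFin f ≈ 0#
  sumFin-zero {n} f≈0 = trans (sumFin-cong f≈0) (trans (sumFin≈sum {n} (λ _ → 0#)) (sum-replicate-zero n))

  sumFin-comm : ∀ {m n} (f : Fin m → Fin n → Carrier) →
                sumFin (λ i → sumFin (f i)) ≈ sumFin (λ j → sumFin (λ i → f i j))
  sumFin-comm f = begin
    sumFin (λ i → sumFin (f i))            ≈⟨ sumFin-cong (λ i → sumFin≈sum (f i)) ⟩
    sumFin (λ i → sum (f i))               ≈⟨ sumFin≈sum (λ i → sum (f i)) ⟩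
    sum (λ i → sum (f i))                  ≈⟨ ∑-comm f ⟩
    sum (λ j → sum (λ i → f i j))          ≈⟨ sumFin≈sum (λ j → sum (λ i → f i j)) ⟨
    sumFin (λ j → sum (λ i → f i j))       ≈⟨ sumFin-cong (λ j → sumFin≈sum (λ i → f i j)) ⟨
    sumFin (λ j → sumFin (λ i → f i j))    ∎

  sumFin-*ʳ : ∀ {n} (f : Fin n → Carrier) κ → sumFin f * κ ≈ sumFin (λ i → f i * κ)
  sumFin-*ʳ f κ = begin
    sumFin f * κ              ≈⟨ *-cong (sumFin≈sum f) refl ⟩
    sum f * κ                 ≈⟨ *-distribʳ-sum κ f ⟩
    sum (λ i → f i * κ)       ≈⟨ sumFin≈sum (λ i → f i * κ) ⟨
    sumFin (λ i → f i * κ)    ∎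

  sumFin-remove : ∀ {n} (f : Fin (suc n) → Carrier) i → sumFin f ≈ f i + sumFin (removeAt f i)
  sumFin-remove f i = begin
    sumFin f                      ≈⟨ sumFin≈sum f ⟩
    sum f                         ≈⟨ sum-remove f ⟩
    f i + sum (removeAt f i)      ≈⟨ +-cong refl (sumFin≈sum (removeAt f i)) ⟨
    f i + sumFin (removeAt f i)   ∎

  sumFin-δ : ∀ {n} (f : Fin n → Carrier) j → (∀ i → i ≢ j → f i ≈ 0#) → sumFin f ≈ f j
  sumFin-δ {suc n} f j f≈0 = begin
    sumFin f                     ≈⟨ sumFin-remove f j ⟩
    f j + sumFin (removeAt f j)  ≈⟨ +-cong refl (sumFin-zero (λ k → f≈0 (punchIn j k) (punchInᵢ≢i j k))) ⟩
    f j + 0#                     ≈⟨ +-identityʳ _ ⟩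
    f j                          ∎

  sumFin-nonneg : ∀ {n} {f : Fin n → Carrier} → (∀ i → NonNegative (f i)) → NonNegative (sumFin f)
  sumFin-nonneg {zero}  f≥0 = inj₂ refl
  sumFin-nonneg {suc n} f≥0 = nonneg-+ (f≥0 Fin.zero) (sumFin-nonneg (f≥0 ∘ Fin.suc))

  sumFin-pos : ∀ {n} (f : Fin n → Carrier) {i} → (∀ k → NonNegative (f k)) → 0# <ᶠ f i → 0# <ᶠ sumFin f
  sumFin-pos {suc n} f {i} f≥0 0<fi =
    pos-resp-≈ (sym (sumFin-remove f i)) (pos+nonneg 0<fi (sumFin-nonneg (λ k → f≥0 (punchIn i k))))

  sumFin-minus-pos : ∀ {n} (f : Fin n → Carrier) {i j} → (∀ k → NonNegative (f k)) → i ≢ j →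
                     0# <ᶠ f i → 0# <ᶠ sumFin f - f j
  sumFin-minus-pos {suc n} f {i} {j} f≥0 i≢j 0<fi =
    pos-resp-≈ (sym (trans (+-cong (sumFin-remove f j) refl) (xyx⁻¹≈y (f j) _)))
      (sumFin-pos (removeAt f j) (λ k → f≥0 (punchIn j k))
        (pos-resp-≈ (reflexive (≡.cong f (≡.sym (punchIn-punchOut j≢i)))) 0<fi))
    where
    j≢i : j ≢ i
    j≢i = i≢j ∘ ≡.sym

  when-cong : ∀ b {t u} → t ≈ u → when b t ≈ when b u
  when-cong true  t≈u = t≈u
  when-cong false _   = refl

  when-∧ : ∀ a b t → when a (when b t) ≡ when (a ∧ b) t
  when-∧ true  b t = ≡.refl
  when-∧ false b t = ≡.refl

  when-nonneg : ∀ b {t} → NonNegative t → NonNegative (when b t)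
  when-nonneg true  t≥0 = t≥0
  when-nonneg false _   = inj₂ refl

  when-sumFin : ∀ {n} b (g : Fin n → Carrier) → when b (sumFin g) ≈ sumFin (λ i → when b (g i))
  when-sumFin true  g = refl
  when-sumFin {n} false g = sym (sumFin-zero {n} (λ _ → refl))

  when-≈ : ∀ {a} {A : Set a} (A? : Dec A) {t u} → (A → t ≈ u) → (¬ A → 0# ≈ u) → when (does A?) t ≈ u
  when-≈ (yes a) t≈u _   = t≈u a
  when-≈ (no ¬a) _   0≈u = 0≈u ¬a

  when-holds : ∀ {a} {A : Set a} (A? : Dec A) {t} → A → when (does A?) t ≈ t
  when-holds (yes _) _ = refl
  when-holds (no ¬a) a = ⊥-elim (¬a a)

  when-dec : ∀ {a b} {A : Set a} {B : Set b} (A? : Dec A) (B? : Dec B) {t u} →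
             (A → B → t ≈ u) → (A → ¬ B → t ≈ 0#) → (B → A) → when (does A?) t ≈ when (does B?) u
  when-dec (yes a) (yes b) t≈u _  _   = t≈u a b
  when-dec (yes a) (no ¬b) _  t≈0 _   = t≈0 a ¬b
  when-dec (no ¬a) (yes b) _  _   b→a = ⊥-elim (¬a (b→a b))
  when-dec (no _)  (no _)  _  _   _   = refl

  when-cong-dec : ∀ {a} {A : Set a} (A? : Dec A) {t u} → (A → t ≈ u) → when (does A?) t ≈ when (does A?) u
  when-cong-dec (yes a) t≈u = t≈u a
  when-cong-dec (no _)  _   = refl

  when-* : ∀ b c t → when b (c * t) ≈ t * when b c
  when-* true  c t = *-comm c t
  when-* false c t = sym (zeroʳ t)

  when-*-when : ∀ a b c t → when a (c * when b t) ≈ when (a ∧ b) (c * t)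
  when-*-when true  true  c t = refl
  when-*-when true  false c t = zeroʳ c
  when-*-when false b     c t = refl

  when-sumFin-∧ : ∀ {n} a (b : Fin n → Bool) (g : Fin n → Carrier) →
                  when a (sumFin (λ i → when (b i) (g i))) ≈ sumFin (λ i → when (a ∧ b i) (g i))
  when-sumFin-∧ a b g =
    trans (when-sumFin a (λ i → when (b i) (g i))) (sumFin-cong (λ i → reflexive (when-∧ a (b i) (g i))))

  sumFin-rotate₄ : ∀ {k m n o} (F : Fin k → Fin m → Fin n → Fin o → Carrier) →
    sumFin (λ s → sumFin (λ y → sumFin (λ x → sumFin (F s y x)))) ≈
    sumFin (λ y → sumFin (λ x → sumFin (λ z → sumFin (λ s → F s y x z))))
  sumFin-rotate₄ F = trans (sumFin-comm (λ s y → sumFin (λ x → sumFin (F s y x))))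
    (sumFin-cong (λ y → trans (sumFin-comm (λ s x → sumFin (F s y x)))
      (sumFin-cong (λ x → sumFin-comm (λ s → F s y x)))))

  module _ {E : Carrier → Carrier} (κ : Carrier) (E-linear : ∀ t → E t ≈ t * κ) where

    linear-sumFin : ∀ {n} (g : Fin n → Carrier) → E (sumFin g) ≈ sumFin (E ∘ g)
    linear-sumFin g = begin
      E (sumFin g)              ≈⟨ E-linear (sumFin g) ⟩
      sumFin g * κ              ≈⟨ sumFin-*ʳ g κ ⟩
      sumFin (λ i → g i * κ)    ≈⟨ sumFin-cong (λ i → E-linear (g i)) ⟨
      sumFin (E ∘ g)            ∎

    linear-when : ∀ b t → E (when b t) ≈ when b (E t)
    linear-when true  t = refl
    linear-when false t = trans (E-linear 0#) (zeroˡ κ)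

    linear-sumFin-when : ∀ {n} (b : Fin n → Bool) (g : Fin n → Carrier) →
                         E (sumFin (λ i → when (b i) (g i))) ≈ sumFin (λ i → when (b i) (E (g i)))
    linear-sumFin-when b g =
      trans (linear-sumFin (λ i → when (b i) (g i))) (sumFin-cong (λ i → linear-when (b i) (g i)))

module ChainSums {c ℓ} (K : OrderedField c ℓ) {d : ℕ} (P : GradedPoset d) (W : Weighted.Weighting K P) where
  open OrderedField K renaming (_<_ to _<ᶠ_)
  open OrderedFieldProperties K
  open GuardedSums K
  open GradedPoset P
  open Weighted.Weighting W
  open Weighted.Ops K P W
  open import Algebra.Properties.Group +-group using (//-rightDividesˡ)

  record Diamond (s x y z : Fin n) : Set where
    field
      s⋖x : s ⋖ x
      s⋖y : s ⋖ y
      x⋖z : x ⋖ z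
      y⋖z : y ⋖ z
      x≢y : x ≢ y

  ⋖⇒rk< : ∀ {a b} → a ⋖ b → rk a ℕ.< rk b
  ⋖⇒rk< a⋖b = ℕ.≤-reflexive (≡.sym (rk-cover a⋖b))

  rk<⇒≢ : ∀ {a b} → rk a ℕ.< rk b → a ≢ b
  rk<⇒≢ rk-a<rk-b a≡b = ℕ.<⇒≢ rk-a<rk-b (≡.cong rk a≡b)

  distinct⇒size≡2+ : ∀ {m} {a b : Fin m} → a ≢ b → ∃ λ j → m ≡ suc (suc j)
  distinct⇒size≡2+ {suc zero}    {Fin.zero} {Fin.zero} a≢b = ⊥-elim (a≢b ≡.refl)
  distinct⇒size≡2+ {suc (suc j)} _                       = j , ≡.refl

  p-nonneg : ∀ y x → NonNegative (p y x)
  p-nonneg y x with x ⋖? y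
  ... | yes x⋖y = inj₁ (p-pos x y x⋖y)
  ... | no  x⋪y = inj₂ (sym (p-zero x y x⋪y))

  chainSum′-nonneg : ∀ k y x → NonNegative (chainSum′ k y x)
  chainSum′-nonneg zero y x with x Fin.≟ y
  ... | yes _ = inj₁ 0<1
  ... | no  _ = inj₂ refl
  chainSum′-nonneg (suc k) y x with x Fin.≟ y
  ... | yes _ = inj₁ 0<1
  ... | no  _ = sumFin-nonneg (λ w →
                  when-nonneg (does (w ⋖? y)) (nonneg-* (p-nonneg y w) (chainSum′-nonneg k w x)))

  chainSum′-refl : ∀ k x → chainSum′ k x x ≈ 1#
  chainSum′-refl zero    x rewrite dec-true (x Fin.≟ x) ≡.refl = refl
  chainSum′-refl (suc k) x rewrite dec-true (x Fin.≟ x) ≡.refl = refl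

  chainSum′-below : ∀ k {w s} → rk w ℕ.≤ rk s → w ≢ s → chainSum′ k w s ≈ 0#
  chainSum′-below zero    {w} {s} _   w≢s rewrite dec-false (s Fin.≟ w) (w≢s ∘ ≡.sym) = refl
  chainSum′-below (suc k) {w} {s} w≤s w≢s rewrite dec-false (s Fin.≟ w) (w≢s ∘ ≡.sym) = sumFin-zero term
    where
    term : ∀ v → when (does (v ⋖? w)) (p w v * chainSum′ k v s) ≈ 0#
    term v = when-≈ (v ⋖? w) below (λ _ → refl)
      where
      below : v ⋖ w → p w v * chainSum′ k v s ≈ 0#
      below v⋖w = trans (*-cong refl (chainSum′-below k (ℕ.<⇒≤ v<s) (rk<⇒≢ v<s))) (zeroʳ _)
        where
        v<s : rk v ℕ.< rk s
        v<s = ℕ.<-≤-trans (⋖⇒rk< v⋖w) w≤s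

  chainSum′-cover : ∀ k {x s} → rk x ≡ suc (rk s) → chainSum′ (suc k) x s ≈ p x s
  chainSum′-cover k {x} {s} rk-x rewrite dec-false (s Fin.≟ x) (rk<⇒≢ (ℕ.≤-reflexive (≡.sym rk-x))) =
    trans (sumFin-δ _ s others) at-s
    where
    others : ∀ w → w ≢ s → when (does (w ⋖? x)) (p x w * chainSum′ k w s) ≈ 0#
    others w w≢s = when-≈ (w ⋖? x) level-s (λ _ → refl)
      where
      level-s : w ⋖ x → p x w * chainSum′ k w s ≈ 0#
      level-s w⋖x = trans (*-cong refl (chainSum′-below k (ℕ.≤-reflexive rk-w) w≢s)) (zeroʳ _)
        where
        rk-w : rk w ≡ rk s
        rk-w = ℕ.suc-injective (≡.trans (≡.sym (rk-cover w⋖x)) rk-x)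
    at-s : when (does (s ⋖? x)) (p x s * chainSum′ k s s) ≈ p x s
    at-s = when-≈ (s ⋖? x) (λ _ → trans (*-cong refl (chainSum′-refl k s)) (*-identityʳ _))
             (λ s⋪x → sym (p-zero s x s⋪x))

  -- chainSum uses fuel n, and n ≥ 2 since x ≠ s: enough for the single recursion step.
  chainSum-cover : ∀ {x s} → rk x ≡ suc (rk s) → chainSum x s ≈ p x s
  chainSum-cover {x} {s} rk-x with distinct⇒size≡2+ (rk<⇒≢ {s} {x} (ℕ.≤-reflexive (≡.sym rk-x)))
  ... | j , n≡2+j = ≡.subst (λ k → chainSum′ k x s ≈ p x s) (≡.sym n≡2+j) (chainSum′-cover (suc j) rk-x)

  module _ {s x y z} (D : Diamond s x y z) where
    open Diamond D

    chainSum′-diamond : ∀ k → 0# <ᶠ chainSum′ (suc (suc k)) z s - p z y * p y s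
    chainSum′-diamond k rewrite dec-false (s Fin.≟ z) (rk<⇒≢ (ℕ.<-trans (⋖⇒rk< s⋖x) (⋖⇒rk< x⋖z))) =
      pos-resp-≈ (+-cong refl (-‿cong G-y)) (sumFin-minus-pos G G-nonneg x≢y G-x-pos)
      where
      G : Fin n → Carrier
      G w = when (does (w ⋖? z)) (p z w * chainSum′ (suc k) w s)
      G-nonneg : ∀ w → NonNegative (G w)
      G-nonneg w = when-nonneg (does (w ⋖? z)) (nonneg-* (p-nonneg z w) (chainSum′-nonneg (suc k) w s))
      G-cover : ∀ {w} → s ⋖ w → w ⋖ z → G w ≈ p z w * p w s
      G-cover {w} s⋖w w⋖z = trans (when-holds (w ⋖? z) w⋖z) (*-cong refl (chainSum′-cover k (rk-cover s⋖w)))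
      G-y : G y ≈ p z y * p y s
      G-y = G-cover s⋖y y⋖z
      G-x-pos : 0# <ᶠ G x
      G-x-pos = pos-resp-≈ (sym (G-cover s⋖x x⋖z)) (*-pos (p-pos x z x⋖z) (p-pos s x s⋖x))

    chainSum-diamond : 0# <ᶠ chainSum z s - p z y * p y s
    chainSum-diamond with distinct⇒size≡2+ x≢y
    ... | j , n≡2+j =
      ≡.subst (λ k → 0# <ᶠ chainSum′ k z s - p z y * p y s) (≡.sym n≡2+j) (chainSum′-diamond j)

    chainSum-diamond-pos : 0# <ᶠ chainSum z s
    chainSum-diamond-pos =
      pos-resp-≈ (//-rightDividesˡ _ _) (pos+nonneg chainSum-diamond (nonneg-* (p-nonneg z y) (p-nonneg y s)))

  1-p-pos : ∀ {x y z} → x ⋖ z → y ⋖ z → x ≢ y → 0# <ᶠ 1# - p z y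
  1-p-pos {x} {y} {z} x⋖z y⋖z x≢y =
    pos-resp-≈ (+-cong (p-sum z z≢∅) (-‿cong (when-holds (y ⋖? z) y⋖z)))
      (sumFin-minus-pos (λ w → when (does (w ⋖? z)) (p z w))
        (λ w → when-nonneg (does (w ⋖? z)) (p-nonneg z w)) x≢y
        (pos-resp-≈ (sym (when-holds (x ⋖? z) x⋖z)) (p-pos x z x⋖z)))
    where
    z≢∅ : z ≢ ∅
    z≢∅ z≡∅ = ℕ.1+n≢0 (≡.trans (≡.sym (rk-cover x⋖z)) (≡.trans (≡.cong rk z≡∅) rk-∅))

module AdjacencyForm {c ℓ} (K : OrderedField c ℓ) {d : ℕ} (P : GradedPoset d) (W : Weighted.Weighting K P) where
  open OrderedField K
  open OrderedFieldProperties K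
  open GuardedSums K
  open Sums K
  open GradedPoset P
  open Weighted.Ops K P W
  open import Relation.Binary.Reasoning.Setoid setoid
  open import Algebra.Solver.Ring.NaturalCoefficients.Default commutativeSemiring

  adjCoeff : (M : Fin n → Carrier) (q : Fin n → Fin n → Carrier) → Fin n → Fin n → Fin n → Carrier
  adjCoeff M q x y z = M z * q z x * q z y * ((1# - q z y) * M y) ⁻¹

  Distinct : (L : Fin n → Set) → Fin n → Fin n → Set
  Distinct L y x = L y × L x × x ≢ y

  distinct? : ∀ {L} → (∀ x → Dec (L x)) → ∀ y x → Dec (Distinct L y x)
  distinct? L? y x = L? y ×-dec L? x ×-dec ¬? (x Fin.≟ y)

  CommonCover : Fin n → Fin n → Fin n → Set
  CommonCover x y z = x ⋖ z × y ⋖ z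

  commonCover? : ∀ x y z → Dec (CommonCover x y z)
  commonCover? x y z = (x ⋖? z) ×-dec (y ⋖? z)

  inner-adj : (M : Fin n → Carrier) (q : Fin n → Fin n → Carrier) {L : Fin n → Set}
              (L? : ∀ x → Dec (L x)) (f : Fin n → Carrier) →
    inner M L? (adj M q L? f) f ≈
    sumFin (λ y → sumFin (λ x → sumFin (λ z →
      when (does (distinct? L? y x ×-dec commonCover? x y z)) (M y * (adjCoeff M q x y z * f x) * f y))))
  inner-adj M q L? f = sumFin-cong expand-y
    where
    Ly : Fin n → Bool
    Ly y = does (L? y)
    Lx≢y : Fin n → Fin n → Bool
    Lx≢y y x = does (L? x ×-dec ¬? (x Fin.≟ y))
    xy⋖z : Fin n → Fin n → Fin n → Bool
    xy⋖z y x z = does (commonCover? x y z)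
    S : Fin n → Fin n → Carrier
    S y x = sumFin (λ z → when (xy⋖z y x z) (adjCoeff M q x y z))
    T : Fin n → Fin n → Fin n → Carrier
    T y x z = M y * (adjCoeff M q x y z * f x) * f y

    expand-x : ∀ y x → M y * (S y x * f x) * f y ≈ sumFin (λ z → when (xy⋖z y x z) (T y x z))
    expand-x y x = linear-sumFin-when (M y * f x * f y)
      (λ t → solve 4 (λ m t g h → m :* (t :* g) :* h := t :* (m :* g :* h)) refl (M y) t (f x) (f y))
      (xy⋖z y x) (adjCoeff M q x y)

    expand-y : ∀ y → when (Ly y) (M y * adj M q L? f y * f y) ≈
                     sumFin (λ x → sumFin (λ z → when (does (distinct? L? y x ×-dec commonCover? x y z)) (T y x z)))
    expand-y y = begin
      when (Ly y) (M y * adj M q L? f y * f y)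
        ≈⟨ when-cong (Ly y) (linear-sumFin-when (M y * f y)
             (λ t → solve 3 (λ m t h → m :* t :* h := t :* (m :* h)) refl (M y) t (f y))
             (Lx≢y y) (λ x → S y x * f x)) ⟩
      when (Ly y) (sumFin (λ x → when (Lx≢y y x) (M y * (S y x * f x) * f y)))
        ≈⟨ when-sumFin (Ly y) (λ x → when (Lx≢y y x) (M y * (S y x * f x) * f y)) ⟩
      sumFin (λ x → when (Ly y) (when (Lx≢y y x) (M y * (S y x * f x) * f y)))
        ≈⟨ sumFin-cong (λ x → when-cong (Ly y) (trans (when-cong (Lx≢y y x) (expand-x y x))
             (when-sumFin (Lx≢y y x) (λ z → when (xy⋖z y x z) (T y x z))))) ⟩
      sumFin (λ x → when (Ly y) (sumFin (λ z → when (Lx≢y y x) (when (xy⋖z y x z) (T y x z)))))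
        ≈⟨ sumFin-cong (λ x → when-sumFin (Ly y) (λ z → when (Lx≢y y x) (when (xy⋖z y x z) (T y x z)))) ⟩
      sumFin (λ x → sumFin (λ z → when (Ly y) (when (Lx≢y y x) (when (xy⋖z y x z) (T y x z)))))
        ≈⟨ sumFin-cong (λ x → sumFin-cong (λ z → reflexive (≡.trans
             (when-∧ (Ly y) (Lx≢y y x) (when (xy⋖z y x z) (T y x z)))
             (when-∧ (Ly y ∧ Lx≢y y x) (xy⋖z y x z) (T y x z))))) ⟩
      sumFin (λ x → sumFin (λ z → when (does (distinct? L? y x ×-dec commonCover? x y z)) (T y x z)))
        ∎

  adjCoeff-weighted : ∀ M q x y z {g h} → Nonzero (M y) → Nonzero (1# - q z y) →
    M y * (adjCoeff M q x y z * g) * h ≈ g * h * (M z * q z x * q z y * (1# - q z y) ⁻¹)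
  adjCoeff-weighted M q x y z {g} {h} My≉0 1-q≉0 = begin
    M y * (adjCoeff M q x y z * g) * h
      ≈⟨ solve 7 (λ m mz qx qy i g h →
             m :* (mz :* qx :* qy :* i :* g) :* h := (m :* i) :* (g :* h :* (mz :* qx :* qy)))
           refl (M y) (M z) (q z x) (q z y) (((1# - q z y) * M y) ⁻¹) g h ⟩
    (M y * ((1# - q z y) * M y) ⁻¹) * (g * h * (M z * q z x * q z y))
      ≈⟨ *-cong (*-cancel-⁻¹ My≉0 1-q≉0) refl ⟩
    (1# - q z y) ⁻¹ * (g * h * (M z * q z x * q z y))
      ≈⟨ solve 6 (λ j g h mz qx qy → j :* (g :* h :* (mz :* qx :* qy)) := g :* h :* (mz :* qx :* qy :* j))
           refl ((1# - q z y) ⁻¹) g h (M z) (q z x) (q z y) ⟩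
    g * h * (M z * q z x * q z y * (1# - q z y) ⁻¹) ∎

  adjTerm-vanishes-q : ∀ M q x y z {g h} → q z x ≈ 0# → M y * (adjCoeff M q x y z * g) * h ≈ 0#
  adjTerm-vanishes-q M q x y z {g} {h} qzx≈0 = ≈0-by-factor
    (solve 7 (λ my mz qx qy i g h →
      my :* (mz :* qx :* qy :* i :* g) :* h := qx :* (my :* mz :* qy :* i :* g :* h))
      refl (M y) (M z) (q z x) (q z y) (((1# - q z y) * M y) ⁻¹) g h)
    qzx≈0

  adjTerm-vanishes-M : ∀ M q x y z {g h} → M y ≈ 0# → M y * (adjCoeff M q x y z * g) * h ≈ 0#
  adjTerm-vanishes-M M q x y z {g} {h} My≈0 = ≈0-by-factor (*-assoc (M y) _ h) My≈0

module LinkWeights {c ℓ} (K : OrderedField c ℓ) {d : ℕ} (P : GradedPoset d) (W : Weighted.Weighting K P) where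
  open OrderedField K
  open OrderedFieldProperties K
  open Weighted.Weighting W
  open Weighted.Ops K P W
  open import Relation.Binary.Reasoning.Setoid setoid
  open import Algebra.Solver.Ring.NaturalCoefficients.Default commutativeSemiring

  link-coefficient : ∀ {s x y z} → Nonzero (chainSum z s) → Nonzero (chainSum z s - p z y * chainSum y s) →
    m s * (m[ s ] z * p[ s ] z x * p[ s ] z y * (1# - p[ s ] z y) ⁻¹) ≈
    m z * p z x * p z y * (chainSum x s * chainSum y s * (chainSum z s - p z y * chainSum y s) ⁻¹)
  link-coefficient {s} {x} {y} {z} Cz≉0 D≉0 = begin
    m s * (m[ s ] z * p[ s ] z x * p[ s ] z y * (1# - p[ s ] z y) ⁻¹)
      ≈⟨ *-cong refl (*-cong refl 1-p⁻¹) ⟩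
    m s * (m[ s ] z * p[ s ] z x * p[ s ] z y * (D ⁻¹ * Cz))
      ≈⟨ solve 10 (λ ms ms⁻¹ mz Cx Cy Cz Cz⁻¹ qx qy D⁻¹ →
           ms :* (mz :* ms⁻¹ :* Cz :* (qx :* Cx :* Cz⁻¹) :* (qy :* Cy :* Cz⁻¹) :* (D⁻¹ :* Cz))
           := (ms :* ms⁻¹) :* (Cz :* Cz⁻¹) :* (Cz :* Cz⁻¹) :* (mz :* qx :* qy :* (Cx :* Cy :* D⁻¹)))
           refl (m s) (m s ⁻¹) (m z) Cx Cy Cz (Cz ⁻¹) (p z x) (p z y) (D ⁻¹) ⟩
    (m s * m s ⁻¹) * (Cz * Cz ⁻¹) * (Cz * Cz ⁻¹) * target
      ≈⟨ *-cong (*-cong (*-cong (⁻¹-inverse (pos⇒nonzero (m-pos s))) (⁻¹-inverse Cz≉0)) (⁻¹-inverse Cz≉0)) refl ⟩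
    1# * 1# * 1# * target
      ≈⟨ trans (*-cong (trans (*-cong (*-identityˡ 1#) refl) (*-identityˡ 1#)) refl) (*-identityˡ target) ⟩
    target ∎
    where
    Cx = chainSum x s
    Cy = chainSum y s
    Cz = chainSum z s
    D = Cz - p z y * Cy
    target = m z * p z x * p z y * (Cx * Cy * D ⁻¹)
    1-p⁻¹ : (1# - p[ s ] z y) ⁻¹ ≈ D ⁻¹ * Cz
    1-p⁻¹ = begin
      (1# - p[ s ] z y) ⁻¹     ≈⟨ ⁻¹-cong (1-x*y⁻¹ Cz≉0) ⟩
      (D * Cz ⁻¹) ⁻¹           ≈⟨ ⁻¹-distrib-* D≉0 (⁻¹-nonzero Cz≉0) ⟩
      D ⁻¹ * Cz ⁻¹ ⁻¹          ≈⟨ *-cong refl (⁻¹-involutive Cz≉0) ⟩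
      D ⁻¹ * Cz                ∎

module LocalToGlobal {c ℓ} (K : OrderedField c ℓ) {d : ℕ} (P : GradedPoset d)
  (W : Weighted.Weighting K P) (standard : Weighted.Standard K P W)
  (AL : Weighted.Ops.PropertyAL K P W) (l : ℕ) (l<d : l ℕ.< d)
  (f : Fin (GradedPoset.n P) → OrderedField.Carrier K) where
  open OrderedField K
  open OrderedFieldProperties K
  open GuardedSums K
  open Sums K
  open GradedPoset P
  open Weighted.Weighting W
  open Weighted.Ops K P W
  open ChainSums K P W
  open AdjacencyForm K P W
  open LinkWeights K P W
  open import Relation.Binary.Reasoning.Setoid setoid
  open import Algebra.Solver.Ring.NaturalCoefficients.Default commutativeSemiring

  below? : ∀ s x y → Dec (s ⋖ x × s ⋖ y)
  below? s x y = (s ⋖? x) ×-dec (s ⋖? y)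

  DiamondOnLevel : Fin n → Fin n → Fin n → Fin n → Set
  DiamondOnLevel y x z s = Distinct (Lev l) y x × CommonCover x y z × s ⋖ x × s ⋖ y

  diamond? : ∀ y x z s → Dec (DiamondOnLevel y x z s)
  diamond? y x z s = distinct? (Lev? l) y x ×-dec commonCover? x y z ×-dec below? s x y

  diamondTerm : Fin n → Fin n → Fin n → Fin n → Carrier
  diamondTerm y x z s = f x * f y * (m z * p z x * p z y * (p x s * p y s * (chainSum z s - p z x * p x s) ⁻¹))

  DiamondSum : Carrier
  DiamondSum = sumFin (λ y → sumFin (λ x → sumFin (λ z → sumFin (λ s →
                 when (does (diamond? y x z s)) (diamondTerm y x z s)))))

  pair-expansion : ∀ {y x} → Distinct (Lev l) y x →
    sumFin (λ z → when (does (commonCover? x y z)) (m y * (adjCoeff m p x y z * f x) * f y)) ≈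
    sumFin (λ z → sumFin (λ s → when (does (commonCover? x y z ×-dec below? s x y)) (diamondTerm y x z s)))
  pair-expansion {y} {x} (ly , lx , x≢y) = begin
    sumFin (λ z → when (cc z) (m y * (adjCoeff m p x y z * f x) * f y))
      ≈⟨ sumFin-cong (λ z → when-cong-dec (commonCover? x y z) weighted) ⟩
    sumFin (λ z → when (cc z) (f x * f y * ALˡ z))
      ≈⟨ linear-sumFin-when (f x * f y) (λ t → *-comm _ t) cc ALˡ ⟨
    f x * f y * sumFin (λ z → when (cc z) (ALˡ z))
      ≈⟨ *-cong refl (AL l l<d x y lx ly x≢y) ⟩
    f x * f y * sumFin (λ z → when (cc z) (m z * p z x * p z y * S z))
      ≈⟨ linear-sumFin-when (f x * f y) (λ t → *-comm _ t) cc (λ z → m z * p z x * p z y * S z) ⟩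
    sumFin (λ z → when (cc z) (f x * f y * (m z * p z x * p z y * S z)))
      ≈⟨ sumFin-cong (λ z → when-cong (cc z) (linear-sumFin-when (f x * f y * (m z * p z x * p z y))
           (λ t → solve 6 (λ g h a b e t → g :* h :* (a :* b :* e :* t) := t :* (g :* h :* (a :* b :* e)))
                    refl (f x) (f y) (m z) (p z x) (p z y) t)
           (λ s → does (below? s x y)) (λ s → p x s * p y s * (chainSum z s - p z x * p x s) ⁻¹))) ⟩
    sumFin (λ z → when (cc z) (sumFin (λ s → when (does (below? s x y)) (diamondTerm y x z s))))
      ≈⟨ sumFin-cong (λ z → when-sumFin-∧ (cc z) (λ s → does (below? s x y)) (diamondTerm y x z)) ⟩
    sumFin (λ z → sumFin (λ s → when (does (commonCover? x y z ×-dec below? s x y)) (diamondTerm y x z s)))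
      ∎
    where
    cc : Fin n → Bool
    cc z = does (commonCover? x y z)
    ALˡ : Fin n → Carrier
    ALˡ z = m z * p z x * p z y * (1# - p z x) ⁻¹
    S : Fin n → Carrier
    S z = sumWhere (λ s → below? s x y) (λ s → p x s * p y s * (chainSum z s - p z x * p x s) ⁻¹)
    weighted : ∀ {z} → CommonCover x y z → m y * (adjCoeff m p x y z * f x) * f y ≈ f x * f y * ALˡ z
    weighted {z} (x⋖z , y⋖z) = trans
      (adjCoeff-weighted m p x y z (pos⇒nonzero (m-pos y)) (pos⇒nonzero (1-p-pos x⋖z y⋖z x≢y)))
      (*-cong refl (*-cong refl (⁻¹-cong (+-cong refl (-‿cong p-zy≈p-zx)))))
      where
      p-zy≈p-zx : p z y ≈ p z x
      p-zy≈p-zx = trans (standard y z y⋖z) (sym (standard x z x⋖z))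

  lhs-expansion : ⟪ A l f , f ⟫[ l ] ≈ DiamondSum
  lhs-expansion = begin
    ⟪ A l f , f ⟫[ l ]
      ≈⟨ inner-adj m p (Lev? l) f ⟩
    sumFin (λ y → sumFin (λ x → sumFin (λ z →
      when (does (distinct? (Lev? l) y x ×-dec commonCover? x y z)) (T y x z))))
      ≈⟨ sumFin-cong (λ y → sumFin-cong (λ x → when-sumFin-∧ (dist y x) (cc y x) (T y x))) ⟨
    sumFin (λ y → sumFin (λ x → when (dist y x) (sumFin (λ z → when (cc y x z) (T y x z)))))
      ≈⟨ sumFin-cong (λ y → sumFin-cong (λ x → when-cong-dec (distinct? (Lev? l) y x) pair-expansion)) ⟩
    sumFin (λ y → sumFin (λ x → when (dist y x) (sumFin (λ z → sumFin (λ s →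
      when (does (commonCover? x y z ×-dec below? s x y)) (diamondTerm y x z s))))))
      ≈⟨ sumFin-cong (λ y → sumFin-cong (λ x → trans
           (when-sumFin (dist y x) (λ z → sumFin (λ s →
             when (does (commonCover? x y z ×-dec below? s x y)) (diamondTerm y x z s))))
           (sumFin-cong (λ z → when-sumFin-∧ (dist y x) _ (diamondTerm y x z))))) ⟩
    DiamondSum ∎
    where
    dist : Fin n → Fin n → Bool
    dist y x = does (distinct? (Lev? l) y x)
    cc : Fin n → Fin n → Fin n → Bool
    cc y x z = does (commonCover? x y z)
    T : Fin n → Fin n → Fin n → Carrier
    T y x z = m y * (adjCoeff m p x y z * f x) * f y

  LinkWedge : Fin n → Fin n → Fin n → Fin n → Set
  LinkWedge s y x z = LevPred l s × Distinct (LinkLev0 s) y x × CommonCover x y z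

  linkWedge? : ∀ s y x z → Dec (LinkWedge s y x z)
  linkWedge? s y x z = LevPred? l s ×-dec distinct? (LinkLev0? s) y x ×-dec commonCover? x y z

  linkTerm : Fin n → Fin n → Fin n → Fin n → Carrier
  linkTerm s y x z = m s * (m[ s ] y * (adjCoeff m[ s ] p[ s ] x y z * f x) * f y)

  link-expansion : ∀ s → when (does (LevPred? l s)) (m s * ⟪ A[ s ] f , f ⟫ₛ[ s ]) ≈
    sumFin (λ y → sumFin (λ x → sumFin (λ z → when (does (linkWedge? s y x z)) (linkTerm s y x z))))
  link-expansion s = begin
    when (lev s) (m s * ⟪ A[ s ] f , f ⟫ₛ[ s ])
      ≈⟨ when-cong (lev s) (*-cong refl (inner-adj m[ s ] p[ s ] (LinkLev0? s) f)) ⟩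
    when (lev s) (m s * sumFin (λ y → sumFin (λ x → sumFin (λ z → when (w y x z) (T y x z)))))
      ≈⟨ linear-sumFin κ E-linear (λ y → sumFin (λ x → sumFin (λ z → when (w y x z) (T y x z)))) ⟩
    sumFin (λ y → when (lev s) (m s * sumFin (λ x → sumFin (λ z → when (w y x z) (T y x z)))))
      ≈⟨ sumFin-cong (λ y → trans (linear-sumFin κ E-linear (λ x → sumFin (λ z → when (w y x z) (T y x z))))
           (sumFin-cong (λ x → trans (linear-sumFin κ E-linear (λ z → when (w y x z) (T y x z)))
             (sumFin-cong (λ z → when-*-when (lev s) (w y x z) (m s) (T y x z)))))) ⟩
    sumFin (λ y → sumFin (λ x → sumFin (λ z → when (does (linkWedge? s y x z)) (linkTerm s y x z)))) ∎
    where
    lev : Fin n → Bool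
    lev s = does (LevPred? l s)
    w : Fin n → Fin n → Fin n → Bool
    w y x z = does (distinct? (LinkLev0? s) y x ×-dec commonCover? x y z)
    T : Fin n → Fin n → Fin n → Carrier
    T y x z = m[ s ] y * (adjCoeff m[ s ] p[ s ] x y z * f x) * f y
    κ : Carrier
    κ = when (lev s) (m s)
    E-linear : ∀ t → when (lev s) (m s * t) ≈ t * κ
    E-linear = when-* (lev s) (m s)

  link-diamond-term : ∀ {s x y z} → Diamond s x y z → linkTerm s y x z ≈ diamondTerm x y z s
  link-diamond-term {s} {x} {y} {z} D = begin
    m s * (m[ s ] y * (adjCoeff m[ s ] p[ s ] x y z * f x) * f y)
      ≈⟨ *-cong refl (adjCoeff-weighted m[ s ] p[ s ] x y z m[s]y≉0 1-p[s]≉0) ⟩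
    m s * (f x * f y * X)
      ≈⟨ solve 4 (λ a g h X → a :* (g :* h :* X) := g :* h :* (a :* X)) refl (m s) (f x) (f y) X ⟩
    f x * f y * (m s * X)
      ≈⟨ *-cong refl (link-coefficient Cz≉0 gap≉0) ⟩
    f x * f y * (m z * p z x * p z y * (Cx * Cy * (Cz - p z y * Cy) ⁻¹))
      ≈⟨ *-cong refl (*-cong refl (*-cong (*-cong Cx≈p Cy≈p) (⁻¹-cong gap≈))) ⟩
    f x * f y * (m z * p z x * p z y * (p x s * p y s * (Cz - p z y * p y s) ⁻¹))
      ≈⟨ solve 8 (λ g h mz a b u v e →
             g :* h :* (mz :* a :* b :* (u :* v :* e)) := h :* g :* (mz :* b :* a :* (v :* u :* e)))
           refl (f x) (f y) (m z) (p z x) (p z y) (p x s) (p y s) ((Cz - p z y * p y s) ⁻¹) ⟩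
    diamondTerm x y z s ∎
    where
    open Diamond D
    Cx = chainSum x s
    Cy = chainSum y s
    Cz = chainSum z s
    X = m[ s ] z * p[ s ] z x * p[ s ] z y * (1# - p[ s ] z y) ⁻¹
    Cx≈p : Cx ≈ p x s
    Cx≈p = chainSum-cover (rk-cover s⋖x)
    Cy≈p : Cy ≈ p y s
    Cy≈p = chainSum-cover (rk-cover s⋖y)
    gap≈ : Cz - p z y * Cy ≈ Cz - p z y * p y s
    gap≈ = +-cong refl (-‿cong (*-cong refl Cy≈p))
    gap≉0 : Nonzero (Cz - p z y * Cy)
    gap≉0 = pos⇒nonzero (pos-resp-≈ (sym gap≈) (chainSum-diamond D))
    Cz≉0 : Nonzero Cz
    Cz≉0 = pos⇒nonzero (chainSum-diamond-pos D)
    m[s]y≉0 : Nonzero (m[ s ] y)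
    m[s]y≉0 = *-nonzero (*-nonzero (pos⇒nonzero (m-pos y)) (⁻¹-nonzero (pos⇒nonzero (m-pos s))))
                (pos⇒nonzero (pos-resp-≈ (sym Cy≈p) (p-pos s y s⋖y)))
    1-p[s]≉0 : Nonzero (1# - p[ s ] z y)
    1-p[s]≉0 1-p≈0 = *-nonzero gap≉0 (⁻¹-nonzero Cz≉0) (trans (sym (1-x*y⁻¹ Cz≉0)) 1-p≈0)

  link-term : ∀ s y x z → when (does (linkWedge? s y x z)) (linkTerm s y x z) ≈
                          when (does (diamond? x y z s)) (diamondTerm x y z s)
  link-term s y x z = when-dec (linkWedge? s y x z) (diamond? x y z s) on-diamond off-diamond diamond⇒wedge
    where
    on-diamond : LinkWedge s y x z → DiamondOnLevel x y z s → linkTerm s y x z ≈ diamondTerm x y z s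
    on-diamond _ ((_ , _ , y≢x) , (y⋖z , x⋖z) , s⋖y , s⋖x) =
      link-diamond-term (record { s⋖x = s⋖x ; s⋖y = s⋖y ; x⋖z = x⋖z ; y⋖z = y⋖z ; x≢y = y≢x ∘ ≡.sym })
    -- LinkLev0 s x does not give s ⋖ x (nothing forces the rank to be strict along <),
    -- but then chainSum x s = p x s = 0 and the term vanishes.
    off-diamond : LinkWedge s y x z → ¬ DiamondOnLevel x y z s → linkTerm s y x z ≈ 0#
    off-diamond (rk-s , ((_ , rk-y) , (_ , rk-x) , x≢y) , (x⋖z , y⋖z)) ¬diamond with s ⋖? x | s ⋖? y
    ... | no s⋪x | _ = trans (*-cong refl (adjTerm-vanishes-q m[ s ] p[ s ] x y z p[s]zx≈0)) (zeroʳ (m s))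
      where
      p[s]zx≈0 : p[ s ] z x ≈ 0#
      p[s]zx≈0 = ≈0-by-factor
        (solve 3 (λ a b c → a :* b :* c := b :* (a :* c)) refl (p z x) (chainSum x s) (chainSum z s ⁻¹))
        (trans (chainSum-cover rk-x) (p-zero s x s⋪x))
    ... | yes _ | no s⋪y = trans (*-cong refl (adjTerm-vanishes-M m[ s ] p[ s ] x y z m[s]y≈0)) (zeroʳ (m s))
      where
      m[s]y≈0 : m[ s ] y ≈ 0#
      m[s]y≈0 = ≈0-by-factor (*-comm _ (chainSum y s)) (trans (chainSum-cover rk-y) (p-zero s y s⋪y))
    ... | yes s⋖x | yes s⋖y = ⊥-elim (¬diamond ((lev rk-x , lev rk-y , x≢y ∘ ≡.sym) , (y⋖z , x⋖z) , s⋖y , s⋖x))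
      where
      lev : ∀ {w} → rk w ≡ suc (rk s) → Lev l w
      lev rk-w = ≡.trans rk-w (≡.cong suc rk-s)
    diamond⇒wedge : DiamondOnLevel x y z s → LinkWedge s y x z
    diamond⇒wedge ((lx , _ , y≢x) , (y⋖z , x⋖z) , s⋖y , s⋖x) =
      ℕ.suc-injective (≡.trans (≡.sym (rk-cover s⋖x)) lx) ,
      ((proj₁ (proj₁ s⋖y) , rk-cover s⋖y) , (proj₁ (proj₁ s⋖x) , rk-cover s⋖x) , y≢x ∘ ≡.sym) ,
      (x⋖z , y⋖z)

  rhs-expansion : sumWhere (LevPred? l) (λ s → m s * ⟪ A[ s ] f , f ⟫ₛ[ s ]) ≈ DiamondSum
  rhs-expansion = begin
    sumWhere (LevPred? l) (λ s → m s * ⟪ A[ s ] f , f ⟫ₛ[ s ])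
      ≈⟨ sumFin-cong link-expansion ⟩
    sumFin (λ s → sumFin (λ y → sumFin (λ x → sumFin (λ z →
      when (does (linkWedge? s y x z)) (linkTerm s y x z)))))
      ≈⟨ sumFin-cong (λ s → sumFin-cong (λ y → sumFin-cong (λ x → sumFin-cong (λ z → link-term s y x z)))) ⟩
    sumFin (λ s → sumFin (λ y → sumFin (λ x → sumFin (λ z → G x y z s))))
      ≈⟨ sumFin-rotate₄ (λ s y x z → G x y z s) ⟩
    sumFin (λ y → sumFin (λ x → sumFin (λ z → sumFin (λ s → G x y z s))))
      ≈⟨ sumFin-comm (λ y x → sumFin (λ z → sumFin (λ s → G x y z s))) ⟩
    DiamondSum ∎
    where
    G : Fin n → Fin n → Fin n → Fin n → Carrier
    G y x z s = when (does (diamond? y x z s)) (diamondTerm y x z s)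

  theorem : ⟪ A l f , f ⟫[ l ] ≈ sumWhere (LevPred? l) (λ s → m s * ⟪ A[ s ] f , f ⟫ₛ[ s ])
  theorem = trans lhs-expansion (sym rhs-expansion)

mainTheorem13 : ∀ {c ℓ : Level} (K : OrderedField c ℓ) (d : ℕ) (P : GradedPoset d)
    (W : Weighted.Weighting K P) →
    Weighted.Standard K P W →
    Weighted.Ops.PropertyAL K P W →
    (l : ℕ) → l < d →
    Weighted.Ops.CoversTwo K P W l →
    (f : Fin (GradedPoset.n P) → OrderedField.Carrier K) →
    OrderedField._≈_ K
      (Weighted.Ops.⟪_,_⟫[_] K P W (Weighted.Ops.A K P W l f) f l)
      (Sums.sumWhere K (Weighted.Ops.LevPred? K P W l)
        (λ s → OrderedField._*_ K (Weighted.Weighting.m W s)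
                 (Weighted.Ops.⟪_,_⟫ₛ[_] K P W (Weighted.Ops.A[_] K P W s f) f s)))
mainTheorem13 K d P W standard AL l l<d _ f = LocalToGlobal.theorem K P W standard AL l l<d f
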